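{- Let $p$ be a prime and $e$ a positive integer such that $\sigma_\infty(p^e)$ is a prime power. Then either $p$ is a Mersenne prime and $e=1$, or $p=2$, $e=2^l$ for some integer $l\ge 0$, and $\sigma_\infty(p^e)=2^{2^l}+1$ is a Fermat prime.
   Context: $\sigma_\infty(p^e)$ is the sum of the infinitary divisors of $p^e$: if $e=\sum_j y_j 2^j$ with $y_j\in\{0,1\}$ is the binary expansion of $e$, then $\sigma_\infty(p^e)=\prod_{j:\,y_j=1}(1+p^{2^j})$. A Mersenne prime is a prime of the form $2^k-1$; a Fermat prime is a prime of the form $2^{2^l}+1$. -}

module Defs where

open import Data.Nat using (ℕ; zero; suc; _+_; _*_; _^_; _≥_)
open import Data.Nat.DivMod using (_/_; _%_)
open import Data.Nat.Primality using (Prime)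
open import Data.Product using (Σ; _×_)
open import Relation.Binary.PropositionalEquality using (_≡_)

-- Fuel-based recursion over the binary digits of e (least significant first);
-- fuel e suffices since e halves at each step (e/2 < e for e ≥ 1).

sigInfAux : ℕ → ℕ → ℕ → ℕ → ℕ
sigInfAux zero    p e j = 1
sigInfAux (suc f) p zero j = 1
sigInfAux (suc f) p e@(suc _) j with e % 2
... | zero  = sigInfAux f p (e / 2) (suc j)
... | suc _ = (1 + p ^ (2 ^ j)) * sigInfAux f p (e / 2) (suc j)

-- σ∞(p^e) = ∏_{j : y_j = 1} (1 + p^(2^j)) where e = Σ_j y_j 2^j.
σ∞ : ℕ → ℕ → ℕ
σ∞ p e = sigInfAux e p e 0

IsPrimePower : ℕ → Set
IsPrimePower n = Σ ℕ λ q → Σ ℕ λ k → Prime q × k ≥ 1 × n ≡ q ^ k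

module Submission where

open import Defs
open import Data.Nat using (ℕ; _^_; _≥_; _∸_; _+_)
open import Data.Nat.Primality using (Prime)
open import Data.Product using (Σ; _×_)
open import Data.Sum using (_⊎_)
open import Relation.Binary.PropositionalEquality using (_≡_)

open import Data.Nat using (zero; suc; _*_; _≤_; _<_; z≤n; s≤s; NonZero; nonTrivial⇒≢1)
open import Data.Nat.Properties
  using (≤-refl; ≤-trans; <⇒≤; ≤-pred; ≤-<-connex; <⇒≱; n≮0; m≤m+n; *-mono-≤; +-comm;
         +-identityʳ; *-comm; *-identityˡ; *-identityʳ; *-zeroʳ; *-suc; suc-injective;
         even≢odd; m+[n∸m]≡n; ^-distribˡ-+-*; ^-*-assoc; m^n>0; m^n≡0⇒m≡0; m^n≡1⇒n≡0∨m≡1)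
open import Data.Nat.DivMod using (_/_; _%_; m≡m%n+[m/n]*n; m%n<n; m/n<m)
open import Data.Nat.Divisibility using (_∣_; divides; _∣?_; ∣-trans; ∣1⇒≡1; ∣m+n∣m⇒∣n; m∣m*n; n∣m*n)
open import Data.Nat.Coprimality using (Coprime; coprime-divisor)
open import Data.Nat.Primality using (prime[2]; prime⇒irreducible; prime⇒nonTrivial; euclidsLemma)
open import Data.Nat.ListAction using (sum; product)
open import Data.Nat.ListAction.Properties using (∈⇒∣product)
open import Data.List using (List; []; _∷_; [_]; map; head)
open import Data.List.Membership.Propositional.Properties using (∈-map⁺)
open import Data.List.Relation.Unary.All as All using (All; []; _∷_)
open import Data.List.Relation.Unary.Linked using (Linked; []; [-]; _∷_; _∷′_)
open import Data.Maybe using (just)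
open import Data.Maybe.Relation.Binary.Connected using (Connected; just; just-nothing)
open import Data.Product using (_,_; ∃; proj₂)
open import Data.Sum using (inj₁; inj₂; [_,_]′)
open import Data.Empty using (⊥; ⊥-elim)
open import Relation.Nullary using (¬_; yes; no)
open import Relation.Binary.PropositionalEquality using (_≢_; refl; sym; trans; cong; subst; module ≡-Reasoning)
open import Data.Nat.Tactic.RingSolver using (solve-∀)

-- Write e = Σ_{j ∈ D} 2^j with D the (strictly increasing) list of binary digits
-- of e, so that σ∞(p^e) = ∏_{j ∈ D} F_p(j) with F_p(j) = 1 + p^(2^j).  If
-- σ∞(p^e) = q^k, every F_p(j) divides q^k, and we show that two digits x < y
-- can never both occur, so e = 2^x and σ∞(p^e) = F_p(x) for a single x.
--   * p odd: every F_p(j) is even, so q = 2; for j ≥ 1, F_p(j) = 1 + a² with a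
--     odd and a > 1 is twice an odd number > 1, which cannot divide 2^k.  Hence
--     the only digit is 0, e = 1 and 1 + p = 2^k: p is a Mersenne prime.
--   * p = 2: the F_2(j) are the Fermat numbers, which are odd and pairwise
--     coprime, so at most one of them is divisible by q.  Finally a Fermat
--     number is not a perfect power q^k with k ≥ 2: not a square (it lies
--     strictly between two consecutive squares), and not an odd power q^k with
--     k ≥ 3 (else (q - 1)(1 + q + … + q^(k-1)) = 2^(2^l) with the second factor
--     odd and > 1).  So k = 1 and σ∞(2^e) is a Fermat prime.

factor : ℕ → ℕ → ℕ
factor p j = 1 + p ^ (2 ^ j)

binaryDigits : ℕ → ℕ → ℕ → List ℕ
binaryDigits zero    e         j = []
binaryDigits (suc f) zero      j = []
binaryDigits (suc f) e@(suc _) j with e % 2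
... | zero  = binaryDigits f (e / 2) (suc j)
... | suc _ = j ∷ binaryDigits f (e / 2) (suc j)

digits : ℕ → List ℕ
digits e = binaryDigits e e 0

sigInfAux-product : ∀ f p e j → sigInfAux f p e j ≡ product (map (factor p) (binaryDigits f e j))
sigInfAux-product zero    p e         j = refl
sigInfAux-product (suc f) p zero      j = refl
sigInfAux-product (suc f) p e@(suc _) j with e % 2
... | zero  = sigInfAux-product f p (e / 2) (suc j)
... | suc _ = cong (factor p j *_) (sigInfAux-product f p (e / 2) (suc j))

σ∞-product : ∀ p e → σ∞ p e ≡ product (map (factor p) (digits e))
σ∞-product p e = sigInfAux-product e p e 0

half-fits : ∀ e {f} → .{{NonZero e}} → e ≤ suc f → e / 2 ≤ f
half-fits e e≤1+f = ≤-pred (≤-trans (m/n<m e 2 (s≤s (s≤s z≤n))) e≤1+f)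

binaryDigits-sum : ∀ f e j → e ≤ f → 2 ^ j * e ≡ sum (map (2 ^_) (binaryDigits f e j))
binaryDigits-sum zero    zero      j _ = *-zeroʳ (2 ^ j)
binaryDigits-sum (suc f) zero      j _ = *-zeroʳ (2 ^ j)
binaryDigits-sum (suc f) e@(suc _) j e≤1+f with e % 2 | m≡m%n+[m/n]*n e 2 | m%n<n e 2
... | zero | e≡ | _ = begin
  2 ^ j * e                                      ≡⟨ cong (2 ^ j *_) e≡ ⟩
  2 ^ j * (0 + e / 2 * 2)                        ≡⟨ even-digit (2 ^ j) (e / 2) ⟩
  2 ^ suc j * (e / 2)                            ≡⟨ binaryDigits-sum f (e / 2) (suc j) (half-fits e e≤1+f) ⟩
  sum (map (2 ^_) (binaryDigits f (e / 2) (suc j))) ∎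
  where
  open ≡-Reasoning
  even-digit : ∀ u h → u * (0 + h * 2) ≡ 2 * u * h
  even-digit = solve-∀
... | suc zero | e≡ | _ = begin
  2 ^ j * e                                      ≡⟨ cong (2 ^ j *_) e≡ ⟩
  2 ^ j * (1 + e / 2 * 2)                        ≡⟨ odd-digit (2 ^ j) (e / 2) ⟩
  2 ^ j + 2 ^ suc j * (e / 2)                    ≡⟨ cong (2 ^ j +_) (binaryDigits-sum f (e / 2) (suc j) (half-fits e e≤1+f)) ⟩
  2 ^ j + sum (map (2 ^_) (binaryDigits f (e / 2) (suc j))) ∎
  where
  open ≡-Reasoning
  odd-digit : ∀ u h → u * (1 + h * 2) ≡ u + 2 * u * h
  odd-digit = solve-∀
... | suc (suc _) | _ | s≤s (s≤s ())

digits-sum : ∀ e → e ≡ sum (map (2 ^_) (digits e))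
digits-sum e = trans (sym (*-identityˡ e)) (binaryDigits-sum e e 0 ≤-refl)

binaryDigits-above : ∀ f e j → All (j ≤_) (binaryDigits f e j)
binaryDigits-above zero    e         j = []
binaryDigits-above (suc f) zero      j = []
binaryDigits-above (suc f) e@(suc _) j with e % 2
... | zero  = All.map <⇒≤ (binaryDigits-above f (e / 2) (suc j))
... | suc _ = ≤-refl ∷ All.map <⇒≤ (binaryDigits-above f (e / 2) (suc j))

binaryDigits-increasing : ∀ f e j → Linked _<_ (binaryDigits f e j)
binaryDigits-increasing zero    e         j = []
binaryDigits-increasing (suc f) zero      j = []
binaryDigits-increasing (suc f) e@(suc _) j with e % 2
... | zero  = binaryDigits-increasing f (e / 2) (suc j)
... | suc _ = below-head (binaryDigits-above f (e / 2) (suc j)) ∷′ binaryDigits-increasing f (e / 2) (suc j)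
  where
  below-head : ∀ {xs} → All (j <_) xs → Connected _<_ (just j) (head xs)
  below-head []          = just-nothing
  below-head (j<x ∷ _)   = just j<x

digits-increasing : ∀ e → Linked _<_ (digits e)
digits-increasing e = binaryDigits-increasing e e 0

at-most-one : ∀ {A : Set} {R : A → A → Set} {P : A → Set} {xs : List A} →
  (∀ {x y} → R x y → P x → P y → ⊥) → Linked R xs → All P xs → xs ≡ [] ⊎ ∃ λ x → xs ≡ [ x ]
at-most-one incompatible []          []             = inj₁ refl
at-most-one incompatible [-]         _              = inj₂ (_ , refl)
at-most-one incompatible (Rxy ∷ _)   (px ∷ py ∷ _)  = ⊥-elim (incompatible Rxy px py)

factors-divide : ∀ p e {n} → σ∞ p e ≡ n → All (λ j → factor p j ∣ n) (digits e)
factors-divide p e refl =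
  All.tabulate λ j∈ → subst (_ ∣_) (sym (σ∞-product p e)) (∈⇒∣product (∈-map⁺ (factor p) j∈))

one-digit : ∀ {P : ℕ → Set} p e → e ≥ 1 → (∀ {x y} → x < y → P x → P y → ⊥) → All P (digits e) →
  Σ ℕ λ x → P x × e ≡ 2 ^ x × σ∞ p e ≡ factor p x
one-digit p e e≥1 incompatible all-P with at-most-one incompatible (digits-increasing e) all-P
... | inj₁ none = ⊥-elim (n≮0 (subst (0 <_) (trans (digits-sum e) (cong (λ ds → sum (map (2 ^_) ds)) none)) e≥1))
... | inj₂ (x , one) = x , All.head (subst (All _) one all-P) , e≡2ˣ , σ≡factor
  where
  e≡2ˣ : e ≡ 2 ^ x
  e≡2ˣ = trans (digits-sum e) (trans (cong (λ ds → sum (map (2 ^_) ds)) one) (+-identityʳ (2 ^ x)))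
  σ≡factor : σ∞ p e ≡ factor p x
  σ≡factor = trans (σ∞-product p e) (trans (cong (λ ds → product (map (factor p) ds)) one) (*-identityʳ (factor p x)))

halve : ∀ n → (∃ λ t → n ≡ 2 * t) ⊎ (∃ λ t → n ≡ 1 + 2 * t)
halve zero = inj₁ (0 , refl)
halve (suc n) with halve n
... | inj₁ (t , refl) = inj₂ (t , refl)
... | inj₂ (t , refl) = inj₁ (suc t , sym (*-suc 2 t))

odd-not-even : ∀ t → ¬ 2 ∣ 1 + 2 * t
odd-not-even t (divides q eq) = even≢odd q t (trans (*-comm 2 q) (sym eq))

odd-form : ∀ {a} → ¬ 2 ∣ a → ∃ λ t → a ≡ 1 + 2 * t
odd-form {a} 2∤a with halve a
... | inj₁ (t , refl) = ⊥-elim (2∤a (divides t (*-comm 2 t)))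
... | inj₂ odd        = odd

odd-successor-even : ∀ {a} → ¬ 2 ∣ a → 2 ∣ 1 + a
odd-successor-even 2∤a with odd-form 2∤a
... | t , refl = divides (suc t) (step t)
  where
  step : ∀ t → 1 + (1 + 2 * t) ≡ suc t * 2
  step = solve-∀

prime≢1 : ∀ {p} → Prime p → p ≢ 1
prime≢1 p-prime = nonTrivial⇒≢1 {{prime⇒nonTrivial p-prime}}

prime-∣-prime : ∀ {r q} → Prime r → Prime q → r ∣ q → r ≡ q
prime-∣-prime r-prime q-prime r∣q with prime⇒irreducible q-prime r∣q
... | inj₁ r≡1 = ⊥-elim (prime≢1 r-prime r≡1)
... | inj₂ r≡q = r≡q

prime-∣-power : ∀ {r m} n → Prime r → r ∣ m ^ n → r ∣ m
prime-∣-power zero    r-prime r∣1 = ⊥-elim (prime≢1 r-prime (∣1⇒≡1 r∣1))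
prime-∣-power {m = m} (suc n) r-prime r∣mⁿ⁺¹ with euclidsLemma m (m ^ n) r-prime r∣mⁿ⁺¹
... | inj₁ r∣m  = r∣m
... | inj₂ r∣mⁿ = prime-∣-power n r-prime r∣mⁿ

coprime-divisor-of-prime-power : ∀ {q d} k → Prime q → ¬ q ∣ d → d ∣ q ^ k → d ≡ 1
coprime-divisor-of-prime-power zero    q-prime q∤d d∣1 = ∣1⇒≡1 d∣1
coprime-divisor-of-prime-power {q} {d} (suc k) q-prime q∤d d∣qᵏ⁺¹ =
  coprime-divisor-of-prime-power k q-prime q∤d (coprime-divisor d⊥q d∣qᵏ⁺¹)
  where
  d⊥q : Coprime d q
  d⊥q (i∣d , i∣q) with prime⇒irreducible q-prime i∣q
  ... | inj₁ i≡1 = i≡1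
  ... | inj₂ refl = ⊥-elim (q∤d i∣d)

prime-∣-divisor-of-prime-power : ∀ {q d} k → Prime q → d ∣ q ^ k → d ≢ 1 → q ∣ d
prime-∣-divisor-of-prime-power {q} {d} k q-prime d∣qᵏ d≢1 with q ∣? d
... | yes q∣d = q∣d
... | no  q∤d = ⊥-elim (d≢1 (coprime-divisor-of-prime-power k q-prime q∤d d∣qᵏ))

odd-divisor-of-2^ : ∀ {d} k → ¬ 2 ∣ d → d ∣ 2 ^ k → d ≡ 1
odd-divisor-of-2^ k = coprime-divisor-of-prime-power k prime[2]

^-double : ∀ a n → a ^ (2 * n) ≡ a ^ n * a ^ n
^-double a n = trans (^-distribˡ-+-* a n (n + 0)) (cong (λ m → a ^ n * a ^ m) (+-identityʳ n))

prime-power≢1 : ∀ {p} n → Prime p → 1 ≤ n → p ^ n ≢ 1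
prime-power≢1 {p} n p-prime 1≤n pⁿ≡1 with m^n≡1⇒n≡0∨m≡1 p n pⁿ≡1
... | inj₁ refl = n≮0 1≤n
... | inj₂ p≡1  = prime≢1 p-prime p≡1

-- If a is odd and 1 + a² divides a power of 2 then a = 1: for a = 1 + 2t,
-- 1 + a² = 2(1 + 2(t² + t)), and the odd factor must be 1.
odd-square-plus-one : ∀ {a} k → ¬ 2 ∣ a → 1 + a * a ∣ 2 ^ k → a ≡ 1
odd-square-plus-one k 2∤a h with odd-form 2∤a
... | t , refl = odd-part-trivial t (odd-divisor-of-2^ k (odd-not-even (t * t + t)) odd-part∣2ᵏ)
  where
  square-plus-one : ∀ t → 1 + (1 + 2 * t) * (1 + 2 * t) ≡ 2 * (1 + 2 * (t * t + t))
  square-plus-one = solve-∀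
  odd-part∣2ᵏ : 1 + 2 * (t * t + t) ∣ 2 ^ k
  odd-part∣2ᵏ = ∣-trans (n∣m*n 2) (subst (_∣ 2 ^ k) (square-plus-one t) h)
  odd-part-trivial : ∀ t → 1 + 2 * (t * t + t) ≡ 1 → 1 + 2 * t ≡ 1
  odd-part-trivial zero    _  = refl
  odd-part-trivial (suc t) ()

-- For an odd prime p, an infinitary factor F_p(j) dividing a prime power q^k
-- forces q = 2 (since F_p(j) = 1 + odd is even) and j = 0 (by the lemma above,
-- as F_p(i+1) = 1 + (p^(2^i))²).
odd-base-factor : ∀ {p q k} j → Prime p → ¬ 2 ∣ p → Prime q → factor p j ∣ q ^ k → q ≡ 2 × j ≡ 0
odd-base-factor {p} {q} {k} j p-prime 2∤p q-prime Fⱼ∣qᵏ =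
  q≡2 , digit-zero j (subst (λ r → factor p j ∣ r ^ k) q≡2 Fⱼ∣qᵏ)
  where
  odd-power : ∀ n → ¬ 2 ∣ p ^ n
  odd-power n 2∣pⁿ = 2∤p (prime-∣-power n prime[2] 2∣pⁿ)
  q≡2 : q ≡ 2
  q≡2 = sym (prime-∣-prime prime[2] q-prime
          (prime-∣-power k prime[2] (∣-trans (odd-successor-even (odd-power (2 ^ j))) Fⱼ∣qᵏ)))
  digit-zero : ∀ j → factor p j ∣ 2 ^ k → j ≡ 0
  digit-zero zero    _    = refl
  digit-zero (suc i) F∣2ᵏ = ⊥-elim (prime-power≢1 (2 ^ i) p-prime (m^n>0 2 i)
    (odd-square-plus-one k (odd-power (2 ^ i)) (subst (_∣ 2 ^ k) (cong suc (^-double p (2 ^ i))) F∣2ᵏ)))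

odd-base-incompatible : ∀ {p q k x y} → Prime p → ¬ 2 ∣ p → Prime q →
  x < y → factor p x ∣ q ^ k → factor p y ∣ q ^ k → ⊥
odd-base-incompatible {k = k} {x} {y} p-prime 2∤p q-prime x<y _ Fy∣qᵏ =
  n≮0 (subst (x <_) (proj₂ (odd-base-factor {k = k} y p-prime 2∤p q-prime Fy∣qᵏ)) x<y)

one-plus-power-of-2-odd : ∀ {n} → 1 ≤ n → ¬ 2 ∣ 1 + 2 ^ n
one-plus-power-of-2-odd {suc m} _ = odd-not-even (2 ^ m)

fermat-odd : ∀ l → ¬ 2 ∣ factor 2 l
fermat-odd l = one-plus-power-of-2-odd (m^n>0 2 l)

fermat≢1 : ∀ l → factor 2 l ≢ 1
fermat≢1 l F≡1 with m^n≡0⇒m≡0 2 (2 ^ l) (suc-injective F≡1)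
... | ()

-- a² ≡ 1 modulo a + 1, hence so is every power of a².
square-power-mod : ∀ {a} → 1 ≤ a → ∀ m → Σ ℕ λ t → (a * a) ^ m ≡ (1 + a) * t + 1
square-power-mod {suc c} _   zero    = 0 , sym (cong (_+ 1) (*-zeroʳ (2 + c)))
square-power-mod {suc c} 1≤a (suc m) with square-power-mod 1≤a m
... | t , eq = c * ((2 + c) * t + 1) + t , trans (cong (suc c * suc c *_) eq) (step c t)
  where
  step : ∀ c t → suc c * suc c * ((2 + c) * t + 1) ≡ (2 + c) * (c * ((2 + c) * t + 1) + t) + 1
  step = solve-∀

tower-split : ∀ a x d → a ^ 2 ^ (suc x + d) ≡ (a ^ 2 ^ x * a ^ 2 ^ x) ^ 2 ^ d
tower-split a x d = begin
  a ^ 2 ^ (suc x + d)           ≡⟨ cong (a ^_) (^-distribˡ-+-* 2 (suc x) d) ⟩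
  a ^ (2 ^ suc x * 2 ^ d)       ≡⟨ sym (^-*-assoc a (2 ^ suc x) (2 ^ d)) ⟩
  (a ^ 2 ^ suc x) ^ 2 ^ d       ≡⟨ cong (_^ 2 ^ d) (^-double a (2 ^ x)) ⟩
  (a ^ 2 ^ x * a ^ 2 ^ x) ^ 2 ^ d ∎
  where open ≡-Reasoning

-- Distinct Fermat numbers are coprime: for x < y, F_y = F_x · t + 2, so a
-- common prime divisor divides 2, while Fermat numbers are odd.
fermat-coprime : ∀ {r x y} → Prime r → x < y → r ∣ factor 2 x → r ∣ factor 2 y → ⊥
fermat-coprime {r} {x} {y} r-prime x<y r∣Fx r∣Fy with square-power-mod (m^n>0 2 (2 ^ x)) (2 ^ (y ∸ suc x))
... | t , eq = fermat-odd x (subst (_∣ factor 2 x) r≡2 r∣Fx)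
  where
  A = 2 ^ 2 ^ x
  d = y ∸ suc x
  shift : ∀ z → 1 + (z + 1) ≡ z + 2
  shift = solve-∀
  Fy≡ : factor 2 y ≡ factor 2 x * t + 2
  Fy≡ = begin
    1 + 2 ^ 2 ^ y            ≡⟨ cong (λ z → 1 + 2 ^ 2 ^ z) (sym (m+[n∸m]≡n x<y)) ⟩
    1 + 2 ^ 2 ^ (suc x + d)  ≡⟨ cong suc (tower-split 2 x d) ⟩
    1 + (A * A) ^ 2 ^ d      ≡⟨ cong suc eq ⟩
    1 + ((1 + A) * t + 1)    ≡⟨ shift ((1 + A) * t) ⟩
    (1 + A) * t + 2          ∎
    where open ≡-Reasoning
  r≡2 : r ≡ 2
  r≡2 = prime-∣-prime r-prime prime[2] (∣m+n∣m⇒∣n (subst (r ∣_) Fy≡ r∣Fy) (∣-trans r∣Fx (m∣m*n t)))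

fermat-factors-incompatible : ∀ {q k x y} → Prime q → x < y → factor 2 x ∣ q ^ k → factor 2 y ∣ q ^ k → ⊥
fermat-factors-incompatible {k = k} {x} {y} q-prime x<y Fx∣qᵏ Fy∣qᵏ = fermat-coprime q-prime x<y
  (prime-∣-divisor-of-prime-power k q-prime Fx∣qᵏ (fermat≢1 x))
  (prime-∣-divisor-of-prime-power k q-prime Fy∣qᵏ (fermat≢1 y))

between-squares : ∀ c X {n} → c * c < n → n < suc c * suc c → X * X ≢ n
between-squares c X lo hi refl with ≤-<-connex X c
... | inj₁ X≤c = <⇒≱ lo (*-mono-≤ X≤c X≤c)
... | inj₂ c<X = <⇒≱ hi (*-mono-≤ c<X c<X)

-- 1 + C² is not a square for C ≥ 1, since C² < 1 + C² < (C + 1)².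
one-plus-square-not-square : ∀ {C} X → 1 ≤ C → X * X ≢ 1 + C * C
one-plus-square-not-square {suc c} X _ = between-squares (suc c) X ≤-refl below-next
  where
  next-square : ∀ c → suc (suc c) * suc (suc c) ≡ (2 + suc c * suc c) + (c + suc c)
  next-square = solve-∀
  below-next : 1 + suc c * suc c < suc (suc c) * suc (suc c)
  below-next = subst (2 + suc c * suc c ≤_) (sym (next-square c)) (m≤m+n _ _)

-- No Fermat number is a square: F_0 = 3, and F_(l+1) = 1 + (2^(2^l))².
fermat-not-square : ∀ l X → X * X ≢ factor 2 l
fermat-not-square zero     X = between-squares 1 X (s≤s (s≤s z≤n)) (s≤s (s≤s (s≤s (s≤s z≤n))))
fermat-not-square (suc l) X XX≡F =
  one-plus-square-not-square X (m^n>0 2 (2 ^ l)) (trans XX≡F (cong suc (^-double 2 (2 ^ l))))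

geom : ℕ → ℕ → ℕ
geom a zero    = 0
geom a (suc k) = 1 + geom a k * a

geom-identity : ∀ c k → suc c ^ k ≡ c * geom (suc c) k + 1
geom-identity c zero    = sym (cong (_+ 1) (*-zeroʳ c))
geom-identity c (suc k) = trans (cong (suc c *_) (geom-identity c k)) (step c (geom (suc c) k))
  where
  step : ∀ c g → suc c * (c * g + 1) ≡ c * (1 + g * suc c) + 1
  step = solve-∀

-- For odd a, a geometric sum with an odd number of terms is odd:
-- geom a (k + 2) = (1 + a) + geom a k · a², with 1 + a even.
geom-odd : ∀ {a} → ¬ 2 ∣ a → ∀ r → ¬ 2 ∣ geom a (1 + 2 * r)
geom-odd 2∤a zero    2∣1 = prime≢1 prime[2] (∣1⇒≡1 2∣1)
geom-odd {a} 2∤a (suc r) 2∣G = geom-odd 2∤a r 2∣G′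
  where
  G′ = geom a (1 + 2 * r)
  two-more : ∀ g a → 1 + (1 + g * a) * a ≡ (1 + a) + g * (a * a)
  two-more = solve-∀
  2∣sum : 2 ∣ (1 + a) + G′ * (a * a)
  2∣sum = subst (2 ∣_) (two-more G′ a) (subst (λ n → 2 ∣ geom a (1 + n)) (*-suc 2 r) 2∣G)
  2∣G′ : 2 ∣ G′
  2∣G′ with euclidsLemma G′ (a * a) prime[2] (∣m+n∣m⇒∣n 2∣sum (odd-successor-even 2∤a))
  ... | inj₁ 2∣G′ = 2∣G′
  ... | inj₂ 2∣aa = ⊥-elim ([ 2∤a , 2∤a ]′ (euclidsLemma a a prime[2] 2∣aa))

-- An odd number c + 1 raised to an odd exponent k ≥ 3 is never 1 + 2^n:
-- otherwise c · geom (c+1) k = 2^n, and the odd factor geom (c+1) k > 1 would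
-- divide 2^n.
odd-power-not-one-plus-2^ : ∀ {c} r n → ¬ 2 ∣ suc c → suc c ^ (1 + 2 * suc r) ≢ 1 + 2 ^ n
odd-power-not-one-plus-2^ {c} r n 2∤a aᵏ≡ = G≢1 (odd-divisor-of-2^ n (geom-odd 2∤a (suc r)) G∣2ⁿ)
  where
  G = geom (suc c) (1 + 2 * suc r)
  cG≡2ⁿ : c * G ≡ 2 ^ n
  cG≡2ⁿ = suc-injective (trans (+-comm 1 (c * G)) (trans (sym (geom-identity c (1 + 2 * suc r))) aᵏ≡))
  G∣2ⁿ : G ∣ 2 ^ n
  G∣2ⁿ = divides c (sym cG≡2ⁿ)
  G≢1 : G ≢ 1
  G≢1 ()

fermat-power-base-odd : ∀ {q} k l → 1 ≤ k → q ^ k ≡ factor 2 l → ¬ 2 ∣ q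
fermat-power-base-odd {q} (suc k) l _ qᵏ≡F 2∣q = fermat-odd l (subst (2 ∣_) qᵏ≡F (∣-trans 2∣q (m∣m*n (q ^ k))))

-- A Fermat number is not a perfect power: if q^k = F_l with k ≥ 1 then k = 1,
-- since an even k makes F_l a square and an odd k ≥ 3 is excluded above.
fermat-power : ∀ {q k} l → q ^ k ≡ factor 2 l → 1 ≤ k → k ≡ 1
fermat-power {q} {k} l qᵏ≡F 1≤k with halve k
... | inj₁ (r , refl)     = ⊥-elim (fermat-not-square l (q ^ r) (trans (sym (^-double q r)) qᵏ≡F))
... | inj₂ (zero , refl)  = refl
... | inj₂ (suc r , refl) with odd-form (fermat-power-base-odd {q} k l 1≤k qᵏ≡F)
...   | t , refl = ⊥-elim (odd-power-not-one-plus-2^ r (2 ^ l) (odd-not-even t) qᵏ≡F)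

lemma2p3 : (p e : ℕ) → Prime p → e ≥ 1 → IsPrimePower (σ∞ p e) →
    ((Σ ℕ λ k → p ≡ 2 ^ k ∸ 1) × e ≡ 1)
    ⊎ (p ≡ 2 × (Σ ℕ λ l → e ≡ 2 ^ l × σ∞ p e ≡ 2 ^ (2 ^ l) + 1 × Prime (σ∞ p e)))
lemma2p3 p e p-prime e≥1 (q , k , q-prime , k≥1 , σ≡qᵏ) with 2 ∣? p
... | no 2∤p with one-digit p e e≥1 (odd-base-incompatible {k = k} p-prime 2∤p q-prime) (factors-divide p e σ≡qᵏ)
...   | x , Fx∣qᵏ , e≡2ˣ , σ≡Fx with odd-base-factor {k = k} x p-prime 2∤p q-prime Fx∣qᵏ
...     | refl , refl = inj₁ ((k , mersenne) , e≡2ˣ)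
  where
  -- 1 + p = σ∞(p^1) = 2^k
  mersenne : p ≡ 2 ^ k ∸ 1
  mersenne = trans (sym (*-identityʳ p)) (cong (_∸ 1) (trans (sym σ≡Fx) σ≡qᵏ))
lemma2p3 p e p-prime e≥1 (q , k , q-prime , k≥1 , σ≡qᵏ) | yes 2∣p with prime-∣-prime prime[2] p-prime 2∣p
... | refl with one-digit 2 e e≥1 (fermat-factors-incompatible {k = k} q-prime) (factors-divide 2 e σ≡qᵏ)
...   | x , _ , e≡2ˣ , σ≡Fx = inj₂ (refl , x , e≡2ˣ , trans σ≡Fx (+-comm 1 (2 ^ 2 ^ x)) , σ-prime)
  where
  σ-prime : Prime (σ∞ 2 e)
  σ-prime with fermat-power x (trans (sym σ≡qᵏ) σ≡Fx) k≥1
  ... | refl = subst Prime (sym (trans σ≡qᵏ (*-identityʳ q))) q-prime
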